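{- The $\mathbb{V}_w$-valued polynomial $x_1e_1+x_2e_2\mapsto p_K(x_1\wedge x_2)^w$ on $V_+\otimes X$ is pluriharmonic.
   Context: $V$ is a real quadratic space of dimension $n+4$ and signature $(4,n)$ with bilinear form $(\,,)$ and a fixed involution $\iota$ such that $\|v\|^2=\tfrac12(v,\iota v)$ is positive definite; $V_+$ (dim $4$) and $V_-$ (dim $n$) are the $\pm1$ eigenspaces of $\iota$, and $K_V\subseteq SO(V)(\mathbb{R})$ is the stabilizer of $\|\cdot\|^2$. Identify $\mathfrak{so}(V)\otimes\mathbb{C}$ with $\wedge^2(V\otimes\mathbb{C})$; the complexified Lie algebra of $K_V$ contains $\mathfrak{so}(V_+)\otimes\mathbb{C}\simeq\mathfrak{sl}_2\oplus\mathfrak{sl}_2$, one factor being the complexified Lie algebra of the long-root $SU(2)$. $p_K:\wedge^2V\otimes\mathbb{C}\to\mathfrak{sl}_2(\mathbb{C})\simeq\mathrm{Sym}^2(V_2)$, $V_2=\mathbb{C}^2$, is the $K_V$-equivariant projection onto this factor (normalized as in Pollack's theory of quaternionic modular forms). $\mathbb{V}_w=\mathrm{Sym}^{2w}(V_2)$ and $p_K(\cdot)^w\in\mathbb{V}_w$ is the image under multiplication $\mathrm{Sym}^w(\mathrm{Sym}^2V_2)\to\mathrm{Sym}^{2w}V_2$. $X$ is a $2$-dimensional space with basis $e_1,e_2$. Pluriharmonic (Kashiwara–Vergne): writing $x_i=\sum_k x_{ki}u_k$ in an orthonormal basis $u_1,\dots,u_4$ of $V_+$ for $\|\cdot\|^2$,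 the polynomial is annihilated by all operators $\Delta_{ij}=\sum_{k=1}^4\partial^2/\partial x_{ki}\partial x_{kj}$, $i,j\in\{1,2\}$. -}

module Defs where

open import Data.Nat using (ℕ; zero; suc)
open import Data.Integer as ℤ using (ℤ; +_; -[1+_])
open import Data.Fin using (Fin; zero; suc)
open import Data.Fin.Properties using () renaming (_≟_ to _≟ᶠ_)
open import Data.Bool using (Bool; true; false; _∧_; if_then_else_)
open import Data.Product using (_×_; _,_; proj₁; proj₂)
open import Relation.Nullary.Decidable using (⌊_⌋)

-- Gaussian integers ℤ[i] (coefficient ring; ℤ[i] ⊂ ℂ)

ℤi : Set
ℤi = ℤ × ℤ

0ᵢ 1ᵢ iᵢ -1ᵢ : ℤi
0ᵢ  = (+ 0 , + 0)
1ᵢ  = (+ 1 , + 0)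
iᵢ  = (+ 0 , + 1)
-1ᵢ = (-[1+ 0 ] , + 0)

_+ᵢ_ : ℤi → ℤi → ℤi
(a , b) +ᵢ (c , d) = (a ℤ.+ c , b ℤ.+ d)

_*ᵢ_ : ℤi → ℤi → ℤi
(a , b) *ᵢ (c , d) = (a ℤ.* c ℤ.- b ℤ.* d , a ℤ.* d ℤ.+ b ℤ.* c)

-- Variables of the polynomial ring on (V₊ ⊗ X) ⊕ V₂:
--   xv k i  = coordinate x_{ki}  (k : orthonormal basis index of V₊, i : e_i of X)
--   yv j    = coordinate of V₂ = ℂ² (Sym^{2w} V₂ = binary forms of degree 2w)

data Var : Set where
  xv : Fin 4 → Fin 2 → Var
  yv : Fin 2 → Var

_==_ : Var → Var → Bool
xv k i == xv l j = ⌊ k ≟ᶠ l ⌋ ∧ ⌊ i ≟ᶠ j ⌋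
xv _ _ == yv _   = false
yv _   == xv _ _ = false
yv a   == yv b   = ⌊ a ≟ᶠ b ⌋

data Poly : Set where
  con  : ℤi → Poly
  var  : Var → Poly
  _⊕_  : Poly → Poly → Poly
  _⊗_  : Poly → Poly → Poly

infixl 6 _⊕_ _⊖_
infixl 7 _⊗_

_⊖_ : Poly → Poly → Poly
p ⊖ q = p ⊕ (con -1ᵢ ⊗ q)

_^ᵖ_ : Poly → ℕ → Poly
p ^ᵖ zero  = con 1ᵢ
p ^ᵖ suc n = p ⊗ (p ^ᵖ n)

eval : (Var → ℤi) → Poly → ℤi
eval ρ (con c) = c
eval ρ (var v) = ρ v
eval ρ (p ⊕ q) = eval ρ p +ᵢ eval ρ q
eval ρ (p ⊗ q) = eval ρ p *ᵢ eval ρ q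

∂ : Var → Poly → Poly
∂ v (con c) = con 0ᵢ
∂ v (var u) = if u == v then con 1ᵢ else con 0ᵢ
∂ v (p ⊕ q) = ∂ v p ⊕ ∂ v q
∂ v (p ⊗ q) = (∂ v p ⊗ q) ⊕ (p ⊗ ∂ v q)

Δ : Fin 2 → Fin 2 → Poly → Poly
Δ i j p = ∂∂ 0F ⊕ ∂∂ 1F ⊕ ∂∂ 2F ⊕ ∂∂ 3F
  where
  0F 1F 2F 3F : Fin 4
  0F = zero
  1F = suc zero
  2F = suc (suc zero)
  3F = suc (suc (suc zero))
  ∂∂ : Fin 4 → Poly
  ∂∂ k = ∂ (xv k i) (∂ (xv k j) p)

-- a polynomial is zero iff it vanishes at every point (coefficient ring infinite domain)
IsZero : Poly → Set
IsZero p = ∀ (ρ : Var → ℤi) → eval ρ p ≡ 0ᵢ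
  where open import Relation.Binary.PropositionalEquality using (_≡_)

Pluriharmonic : Poly → Set
Pluriharmonic p = ∀ (i j : Fin 2) → IsZero (Δ i j p)

private
  f0 f1 f2 f3 : Fin 4
  f0 = zero
  f1 = suc zero
  f2 = suc (suc zero)
  f3 = suc (suc (suc zero))
  e1 e2 : Fin 2
  e1 = zero
  e2 = suc zero

-- coefficient of u_k ∧ u_l in x₁ ∧ x₂
m : Fin 4 → Fin 4 → Poly
m k l = var (xv k e1) ⊗ var (xv l e2) ⊖ var (xv l e1) ⊗ var (xv k e2)

-- coordinates of the projection of x₁ ∧ x₂ to the (anti)self-dual summand
-- ∧²₊ V₊ = so(V₊)-factor, in the orthogonal basis
--   u₁∧u₂ + u₃∧u₄ ,  u₁∧u₃ + u₄∧u₂ ,  u₁∧u₄ + u₂∧u₃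
ω₁ ω₂ ω₃ : Poly
ω₁ = m f0 f1 ⊕ m f2 f3
ω₂ = m f0 f2 ⊕ m f3 f1
ω₃ = m f0 f3 ⊕ m f1 f2

-- p_K(x₁ ∧ x₂) ∈ Sym²(V₂) as the binary quadratic form a X² + 2b XY + c Y²
-- with a = ω₁ + iω₂, b = ω₃, c = -ω₁ + iω₂  (b² − ac = ω₁² + ω₂² + ω₃², so this
-- is an isometry up to scalar of ∧²₊V₊⊗ℂ ≅ sl₂ ≅ Sym²V₂, i.e. p_K up to the
-- K-equivariant identification / normalising constant)
pK : Poly
pK = (ω₁ ⊕ con iᵢ ⊗ ω₂) ⊗ X ⊗ X
   ⊕ con (+ 2 , + 0) ⊗ ω₃ ⊗ X ⊗ Y
   ⊕ (con iᵢ ⊗ ω₂ ⊖ ω₁) ⊗ Y ⊗ Y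
  where
  X Y : Poly
  X = var (yv e1)
  Y = var (yv e2)

pKpow : ℕ → Poly
pKpow w = pK ^ᵖ w

{-# OPTIONS --safe #-}
module Submission where

-- Write Γ i j p q = Σₖ ∂p/∂x_{ki} · ∂q/∂x_{kj}. By the Leibniz rule
--   Δ i j (p q) = (Δ i j p) q + Γ j i p q + Γ i j p q + p (Δ i j q),
-- and Γ i j p is a derivation, so Γ i j p (p ^ w) = w p ^ (w - 1) Γ i j p p.
-- Hence if p is pluriharmonic and its gradients are isotropic (Γ i j p p = 0
-- for all i, j), induction on w shows that every power of p is pluriharmonic.
-- For p = p_K(x₁ ∧ x₂) both hypotheses are polynomial identities, checked by
-- ring normalisation. Isotropy is the substantial one: p_K = Σᵣ φᵣ ωᵣ with
-- φ = (X² − Y², i(X² + Y²), 2XY) a null vector, and the self-dual forms obey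
-- the Clifford relations Γ i j ωᵣ ωₛ + Γ i j ωₛ ωᵣ = 2 δᵣₛ Γ i j ω₁ ω₁, so
-- Γ i j p_K p_K = (Σᵣ φᵣ²) Γ i j ω₁ ω₁ = 0.

open import Defs
open import Algebra.Bundles using (CommutativeSemiring)
open import Data.Fin using (Fin; zero; suc; _↑ˡ_; _↑ʳ_; splitAt; combine; remQuot)
open import Data.Fin.Properties using (splitAt-↑ˡ; splitAt-↑ʳ; remQuot-combine)
open import Data.Integer as ℤ using ()
import Data.Integer.Properties as ℤₚ
open import Data.Integer.Tactic.RingSolver as ℤ-Solver using ()
open import Data.Nat using (ℕ; zero; suc)
open import Data.Product using (_,_; uncurry)
open import Data.Product.Properties using (≡-dec)
open import Data.Sum using ([_,_]′)
open import Data.Vec using (Vec; tabulate)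
open import Data.Vec.Properties using (lookup∘tabulate)
open import Function using (_∘_)
open import Relation.Binary.PropositionalEquality
open import Relation.Nullary.Decidable using (dec⇒maybe)
open import Algebra.Structures {A = ℤi} _≡_ using (IsCommutativeMonoid)
open import Algebra.Structures.Biased {A = ℤi} _≡_ using (isCommutativeSemiringˡ)
import Tactic.RingSolver.Core.AlmostCommutativeRing as ACR
open import Tactic.RingSolver.Core.Expression using (Expr; Κ; Ι)
  renaming (_⊕_ to _:+_; _⊗_ to _:*_)
import Tactic.RingSolver.NonReflective as NonReflective
open ≡-Reasoning

+ᵢ-isCommutativeMonoid : IsCommutativeMonoid _+ᵢ_ 0ᵢ
+ᵢ-isCommutativeMonoid = record
  { isMonoid = record
    { isSemigroup = record
      { isMagma = record { isEquivalence = isEquivalence ; ∙-cong = cong₂ _+ᵢ_ }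
      ; assoc = λ (a , b) (c , d) (e , f) → cong₂ _,_ (ℤₚ.+-assoc a c e) (ℤₚ.+-assoc b d f)
      }
    ; identity = (λ (a , b) → cong₂ _,_ (ℤₚ.+-identityˡ a) (ℤₚ.+-identityˡ b))
               , (λ (a , b) → cong₂ _,_ (ℤₚ.+-identityʳ a) (ℤₚ.+-identityʳ b))
    }
  ; comm = λ (a , b) (c , d) → cong₂ _,_ (ℤₚ.+-comm a c) (ℤₚ.+-comm b d)
  }

*ᵢ-isCommutativeMonoid : IsCommutativeMonoid _*ᵢ_ 1ᵢ
*ᵢ-isCommutativeMonoid = record
  { isMonoid = record
    { isSemigroup = record
      { isMagma = record { isEquivalence = isEquivalence ; ∙-cong = cong₂ _*ᵢ_ }
      ; assoc = λ (a , b) (c , d) (e , f) → cong₂ _,_ (assoc-re a b c d e f) (assoc-im a b c d e f)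
      }
    ; identity = (λ (a , b) → cong₂ _,_ (identityˡ-re a b) (identityˡ-im a b))
               , (λ (a , b) → cong₂ _,_ (identityʳ-re a b) (identityʳ-im a b))
    }
  ; comm = λ (a , b) (c , d) → cong₂ _,_ (comm-re a b c d) (comm-im a b c d)
  }
  where
  open ℤ using (_+_; _*_; _-_)
  open ℤ-Solver using (solve-∀)
  assoc-re : ∀ a b c d e f → (a * c - b * d) * e - (a * d + b * c) * f ≡ a * (c * e - d * f) - b * (c * f + d * e)
  assoc-re = solve-∀
  assoc-im : ∀ a b c d e f → (a * c - b * d) * f + (a * d + b * c) * e ≡ a * (c * f + d * e) + b * (c * e - d * f)
  assoc-im = solve-∀
  identityˡ-re : ∀ a b → ℤ.+ 1 * a - ℤ.+ 0 * b ≡ a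
  identityˡ-re = solve-∀
  identityˡ-im : ∀ a b → ℤ.+ 1 * b + ℤ.+ 0 * a ≡ b
  identityˡ-im = solve-∀
  identityʳ-re : ∀ a b → a * ℤ.+ 1 - b * ℤ.+ 0 ≡ a
  identityʳ-re = solve-∀
  identityʳ-im : ∀ a b → a * ℤ.+ 0 + b * ℤ.+ 1 ≡ b
  identityʳ-im = solve-∀
  comm-re : ∀ a b c d → a * c - b * d ≡ c * a - d * b
  comm-re = solve-∀
  comm-im : ∀ a b c d → a * d + b * c ≡ c * b + d * a
  comm-im = solve-∀

ℤi-commutativeSemiring : CommutativeSemiring _ _
ℤi-commutativeSemiring = record
  { isCommutativeSemiring = isCommutativeSemiringˡ record
    { +-isCommutativeMonoid = +ᵢ-isCommutativeMonoid
    ; *-isCommutativeMonoid = *ᵢ-isCommutativeMonoid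
    ; distribʳ = λ (a , b) (c , d) (e , f) → cong₂ _,_ (distribʳ-re a b c d e f) (distribʳ-im a b c d e f)
    ; zeroˡ    = λ (a , b) → cong₂ _,_ (zeroˡ-re a b) (zeroˡ-re b a)
    }
  }
  where
  open ℤ using (_+_; _*_; _-_)
  open ℤ-Solver using (solve-∀)
  distribʳ-re : ∀ a b c d e f → (c + e) * a - (d + f) * b ≡ (c * a - d * b) + (e * a - f * b)
  distribʳ-re = solve-∀
  distribʳ-im : ∀ a b c d e f → (c + e) * b + (d + f) * a ≡ (c * b + d * a) + (e * b + f * a)
  distribʳ-im = solve-∀
  zeroˡ-re : ∀ a b → ℤ.+ 0 * a - ℤ.+ 0 * b ≡ ℤ.+ 0
  zeroˡ-re = solve-∀

open CommutativeSemiring ℤi-commutativeSemiring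
  using (_+_; _*_; 0#; +-assoc; zeroˡ; zeroʳ; *-assoc; distribˡ; semiring; *-commutativeSemigroup)
open import Algebra.Properties.CommutativeSemigroup *-commutativeSemigroup using (x∙yz≈y∙xz)
open import Algebra.Properties.Semiring.Sum semiring
  using (sum; sum-syntax; sum-cong-≗; ∑-distrib-+; *-distribˡ-sum; *-distribʳ-sum)

-- fromCommutativeSemiring interprets negation as the identity; harmless,
-- since Poly has no negation and toExpr below never produces one.
ℤi-almostCommutativeRing : ACR.AlmostCommutativeRing _ _
ℤi-almostCommutativeRing = ACR.fromCommutativeSemiring ℤi-commutativeSemiring
  (λ x → dec⇒maybe (≡-dec ℤ._≟_ ℤ._≟_ 0ᵢ x))

open NonReflective ℤi-almostCommutativeRing using (module Ops)

toFin : Var → Fin 10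
toFin (xv k i) = combine k i ↑ˡ 2
toFin (yv a)   = 8 ↑ʳ a

fromFin : Fin 10 → Var
fromFin = [ uncurry xv ∘ remQuot 2 , yv ]′ ∘ splitAt 8

fromFin-toFin : ∀ v → fromFin (toFin v) ≡ v
fromFin-toFin (xv k i) = trans (cong [ uncurry xv ∘ remQuot 2 , yv ]′ (splitAt-↑ˡ 8 (combine k i) 2))
                               (cong (uncurry xv) (remQuot-combine k i))
fromFin-toFin (yv a)   = cong [ uncurry xv ∘ remQuot 2 , yv ]′ (splitAt-↑ʳ 8 2 a)

toExpr : Poly → Expr ℤi 10
toExpr (con c) = Κ c
toExpr (var v) = Ι (toFin v)
toExpr (p ⊕ q) = toExpr p :+ toExpr q
toExpr (p ⊗ q) = toExpr p :* toExpr q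

toVec : (Var → ℤi) → Vec ℤi 10
toVec ρ = tabulate (ρ ∘ fromFin)

eval-toExpr : ∀ ρ p → eval ρ p ≡ Ops.⟦ toExpr p ⟧ (toVec ρ)
eval-toExpr ρ (con c) = refl
eval-toExpr ρ (var v) = sym (trans (lookup∘tabulate (ρ ∘ fromFin) (toFin v)) (cong ρ (fromFin-toFin v)))
eval-toExpr ρ (p ⊕ q) = cong₂ _+ᵢ_ (eval-toExpr ρ p) (eval-toExpr ρ q)
eval-toExpr ρ (p ⊗ q) = cong₂ _*ᵢ_ (eval-toExpr ρ p) (eval-toExpr ρ q)

normalForm≡0⇒IsZero : ∀ p → (∀ xs → Ops.⟦ toExpr p ⇓⟧ xs ≡ 0ᵢ) → IsZero p
normalForm≡0⇒IsZero p nf≡0 ρ = begin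
  eval ρ p                   ≡⟨ eval-toExpr ρ p ⟩
  Ops.⟦ toExpr p ⟧ (toVec ρ)  ≡⟨ Ops.correct (toExpr p) (toVec ρ) ⟨
  Ops.⟦ toExpr p ⇓⟧ (toVec ρ) ≡⟨ nf≡0 (toVec ρ) ⟩
  0ᵢ                         ∎

-- Nested like the library's sum, so that eval ρ (Γ i j p q) is definitionally a ∑[ k < 4 ].
Γ : Fin 2 → Fin 2 → Poly → Poly → Poly
Γ i j p q = ∂∂ zero ⊕ (∂∂ (suc zero) ⊕ (∂∂ (suc (suc zero)) ⊕ (∂∂ (suc (suc (suc zero))) ⊕ con 0ᵢ)))
  where
  ∂∂ : Fin 4 → Poly
  ∂∂ k = ∂ (xv k i) p ⊗ ∂ (xv k j) q

Δ-as-sum : ∀ ρ i j p → eval ρ (Δ i j p) ≡ ∑[ k < 4 ] eval ρ (∂ (xv k i) (∂ (xv k j) p))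
Δ-as-sum ρ i j p = reassociate (t zero) (t (suc zero)) (t (suc (suc zero))) (t (suc (suc (suc zero))))
  where
  t : Fin 4 → ℤi
  t k = eval ρ (∂ (xv k i) (∂ (xv k j) p))
  open import Tactic.RingSolver using (solve-∀)
  reassociate : ∀ a b c d → ((a +ᵢ b) +ᵢ c) +ᵢ d ≡ a +ᵢ (b +ᵢ (c +ᵢ (d +ᵢ 0ᵢ)))
  reassociate = solve-∀ ℤi-almostCommutativeRing

∂∂-⊗ : ∀ ρ u v p q →
  eval ρ (∂ u (∂ v (p ⊗ q))) ≡
    eval ρ (∂ u (∂ v p)) * eval ρ q
    + (eval ρ (∂ v p) * eval ρ (∂ u q) + eval ρ (∂ u p) * eval ρ (∂ v q))
    + eval ρ p * eval ρ (∂ u (∂ v q))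
∂∂-⊗ ρ u v p q = trans (sym (+-assoc (a + b) c d)) (cong (_+ d) (+-assoc a b c))
  where
  a b c d : ℤi
  a = eval ρ (∂ u (∂ v p)) * eval ρ q
  b = eval ρ (∂ v p) * eval ρ (∂ u q)
  c = eval ρ (∂ u p) * eval ρ (∂ v q)
  d = eval ρ p * eval ρ (∂ u (∂ v q))

Δ-⊗ : ∀ ρ i j p q →
  eval ρ (Δ i j (p ⊗ q)) ≡
    eval ρ (Δ i j p) * eval ρ q + (eval ρ (Γ j i p q) + eval ρ (Γ i j p q)) + eval ρ p * eval ρ (Δ i j q)
Δ-⊗ ρ i j p q = begin
  eval ρ (Δ i j (p ⊗ q))
    ≡⟨ Δ-as-sum ρ i j (p ⊗ q) ⟩
  ∑[ k < 4 ] eval ρ (∂ (xv k i) (∂ (xv k j) (p ⊗ q)))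
    ≡⟨ sum-cong-≗ (λ k → ∂∂-⊗ ρ (xv k i) (xv k j) p q) ⟩
  ∑[ k < 4 ] (Δₖp k * eval ρ q + Γₖ k + eval ρ p * Δₖq k)
    ≡⟨ ∑-distrib-+ (λ k → Δₖp k * eval ρ q + Γₖ k) (λ k → eval ρ p * Δₖq k) ⟩
  ∑[ k < 4 ] (Δₖp k * eval ρ q + Γₖ k) + ∑[ k < 4 ] (eval ρ p * Δₖq k)
    ≡⟨ cong₂ _+_ (∑-distrib-+ (λ k → Δₖp k * eval ρ q) Γₖ) (sym (*-distribˡ-sum (eval ρ p) Δₖq)) ⟩
  ∑[ k < 4 ] (Δₖp k * eval ρ q) + sum Γₖ + eval ρ p * sum Δₖq
    ≡⟨ cong (λ s → s + sum Γₖ + eval ρ p * sum Δₖq) (sym (*-distribʳ-sum (eval ρ q) Δₖp)) ⟩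
  sum Δₖp * eval ρ q + sum Γₖ + eval ρ p * sum Δₖq
    ≡⟨ cong₂ (λ s t → s * eval ρ q + sum Γₖ + eval ρ p * t) (sym (Δ-as-sum ρ i j p)) (sym (Δ-as-sum ρ i j q)) ⟩
  eval ρ (Δ i j p) * eval ρ q + sum Γₖ + eval ρ p * eval ρ (Δ i j q)
    ≡⟨ cong (λ s → eval ρ (Δ i j p) * eval ρ q + s + eval ρ p * eval ρ (Δ i j q))
               (∑-distrib-+ (λ k → eval ρ (∂ (xv k j) p) * eval ρ (∂ (xv k i) q))
                            (λ k → eval ρ (∂ (xv k i) p) * eval ρ (∂ (xv k j) q))) ⟩
  eval ρ (Δ i j p) * eval ρ q + (eval ρ (Γ j i p q) + eval ρ (Γ i j p q)) + eval ρ p * eval ρ (Δ i j q)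
    ∎
  where
  Δₖp Δₖq Γₖ : Fin 4 → ℤi
  Δₖp k = eval ρ (∂ (xv k i) (∂ (xv k j) p))
  Δₖq k = eval ρ (∂ (xv k i) (∂ (xv k j) q))
  Γₖ  k = eval ρ (∂ (xv k j) p) * eval ρ (∂ (xv k i) q) + eval ρ (∂ (xv k i) p) * eval ρ (∂ (xv k j) q)

Γ-⊗ʳ : ∀ ρ i j p q r →
  eval ρ (Γ i j p (q ⊗ r)) ≡ eval ρ (Γ i j p q) * eval ρ r + eval ρ q * eval ρ (Γ i j p r)
Γ-⊗ʳ ρ i j p q r = begin
  ∑[ k < 4 ] (∂ᵢp k * (∂ⱼq k * eval ρ r + eval ρ q * ∂ⱼr k))
    ≡⟨ sum-cong-≗ (λ k → distribˡ (∂ᵢp k) (∂ⱼq k * eval ρ r) (eval ρ q * ∂ⱼr k)) ⟩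
  ∑[ k < 4 ] (∂ᵢp k * (∂ⱼq k * eval ρ r) + ∂ᵢp k * (eval ρ q * ∂ⱼr k))
    ≡⟨ sum-cong-≗ (λ k → cong₂ _+_ (sym (*-assoc (∂ᵢp k) (∂ⱼq k) (eval ρ r)))
                                    (x∙yz≈y∙xz (∂ᵢp k) (eval ρ q) (∂ⱼr k))) ⟩
  ∑[ k < 4 ] (∂ᵢp k * ∂ⱼq k * eval ρ r + eval ρ q * (∂ᵢp k * ∂ⱼr k))
    ≡⟨ ∑-distrib-+ (λ k → ∂ᵢp k * ∂ⱼq k * eval ρ r) (λ k → eval ρ q * (∂ᵢp k * ∂ⱼr k)) ⟩
  ∑[ k < 4 ] (∂ᵢp k * ∂ⱼq k * eval ρ r) + ∑[ k < 4 ] (eval ρ q * (∂ᵢp k * ∂ⱼr k))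
    ≡⟨ cong₂ _+_ (sym (*-distribʳ-sum (eval ρ r) (λ k → ∂ᵢp k * ∂ⱼq k)))
                 (sym (*-distribˡ-sum (eval ρ q) (λ k → ∂ᵢp k * ∂ⱼr k))) ⟩
  eval ρ (Γ i j p q) * eval ρ r + eval ρ q * eval ρ (Γ i j p r)
    ∎
  where
  ∂ᵢp ∂ⱼq ∂ⱼr : Fin 4 → ℤi
  ∂ᵢp k = eval ρ (∂ (xv k i) p)
  ∂ⱼq k = eval ρ (∂ (xv k j) q)
  ∂ⱼr k = eval ρ (∂ (xv k j) r)

Γ-conʳ : ∀ ρ i j p c → eval ρ (Γ i j p (con c)) ≡ 0ᵢ
Γ-conʳ ρ i j p c = trans (sym (*-distribʳ-sum 0# (λ k → eval ρ (∂ (xv k i) p))))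
                         (zeroʳ (∑[ k < 4 ] eval ρ (∂ (xv k i) p)))

IsotropicGradients : Poly → Set
IsotropicGradients p = ∀ i j → IsZero (Γ i j p p)

Γ-^ʳ : ∀ p i j → IsZero (Γ i j p p) → ∀ w → IsZero (Γ i j p (p ^ᵖ w))
Γ-^ʳ p i j Γpp≡0 zero    ρ = Γ-conʳ ρ i j p 1ᵢ
Γ-^ʳ p i j Γpp≡0 (suc w) ρ = begin
  eval ρ (Γ i j p (p ⊗ p ^ᵖ w))
    ≡⟨ Γ-⊗ʳ ρ i j p p (p ^ᵖ w) ⟩
  eval ρ (Γ i j p p) * eval ρ (p ^ᵖ w) + eval ρ p * eval ρ (Γ i j p (p ^ᵖ w))
    ≡⟨ cong₂ (λ a b → a * eval ρ (p ^ᵖ w) + eval ρ p * b) (Γpp≡0 ρ) (Γ-^ʳ p i j Γpp≡0 w ρ) ⟩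
  0# * eval ρ (p ^ᵖ w) + eval ρ p * 0#
    ≡⟨ cong₂ _+_ (zeroˡ (eval ρ (p ^ᵖ w))) (zeroʳ (eval ρ p)) ⟩
  0# + 0#
    ≡⟨⟩
  0#
    ∎

pluriharmonic-^ : ∀ p → Pluriharmonic p → IsotropicGradients p → ∀ w → Pluriharmonic (p ^ᵖ w)
pluriharmonic-^ p harmonic isotropic zero    i j ρ = refl
pluriharmonic-^ p harmonic isotropic (suc w) i j ρ = begin
  eval ρ (Δ i j (p ⊗ p ^ᵖ w))
    ≡⟨ Δ-⊗ ρ i j p (p ^ᵖ w) ⟩
  eval ρ (Δ i j p) * eval ρ (p ^ᵖ w) + (eval ρ (Γ j i p (p ^ᵖ w)) + eval ρ (Γ i j p (p ^ᵖ w)))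
    + eval ρ p * eval ρ (Δ i j (p ^ᵖ w))
    ≡⟨ cong₂ (λ a b → a * eval ρ (p ^ᵖ w) + b + eval ρ p * eval ρ (Δ i j (p ^ᵖ w)))
             (harmonic i j ρ)
             (cong₂ _+_ (Γ-^ʳ p j i (isotropic j i) w ρ) (Γ-^ʳ p i j (isotropic i j) w ρ)) ⟩
  0# * eval ρ (p ^ᵖ w) + (0# + 0#) + eval ρ p * eval ρ (Δ i j (p ^ᵖ w))
    ≡⟨ cong₂ (λ a c → a + (0# + 0#) + c)
             (zeroˡ (eval ρ (p ^ᵖ w)))
             (trans (cong (eval ρ p *_) (pluriharmonic-^ p harmonic isotropic w i j ρ)) (zeroʳ (eval ρ p))) ⟩
  0# + (0# + 0#) + 0#
    ≡⟨⟩
  0#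
    ∎

pK-pluriharmonic : Pluriharmonic pK
pK-pluriharmonic zero       zero       = normalForm≡0⇒IsZero (Δ zero zero pK) (λ _ → refl)
pK-pluriharmonic zero       (suc zero) = normalForm≡0⇒IsZero (Δ zero (suc zero) pK) (λ _ → refl)
pK-pluriharmonic (suc zero) zero       = normalForm≡0⇒IsZero (Δ (suc zero) zero pK) (λ _ → refl)
pK-pluriharmonic (suc zero) (suc zero) = normalForm≡0⇒IsZero (Δ (suc zero) (suc zero) pK) (λ _ → refl)

pK-isotropicGradients : IsotropicGradients pK
pK-isotropicGradients zero       zero       = normalForm≡0⇒IsZero (Γ zero zero pK pK) (λ _ → refl)
pK-isotropicGradients zero       (suc zero) = normalForm≡0⇒IsZero (Γ zero (suc zero) pK pK) (λ _ → refl)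
pK-isotropicGradients (suc zero) zero       = normalForm≡0⇒IsZero (Γ (suc zero) zero pK pK) (λ _ → refl)
pK-isotropicGradients (suc zero) (suc zero) = normalForm≡0⇒IsZero (Γ (suc zero) (suc zero) pK pK) (λ _ → refl)

lemma3p1 : (w : ℕ) → Pluriharmonic (pKpow w)
lemma3p1 = pluriharmonic-^ pK pK-pluriharmonic pK-isotropicGradients
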